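{- Let $G$ be a graph and $P$ a path of length at least $2$ such that $G$ and $\{P\}$ are near-disjoint. If $G\curlyvee P$ admits a $k$-page book embedding, then $G\curlyvee P'$ admits a $k$-page book embedding, where $P'$ is obtained from $P$ by subdividing an arbitrary edge of $P$ once.
   Context: A $k$-page book embedding of a graph $G=(V,E)$ is a pair $\langle\prec,\sigma\rangle$ where $\prec$ is a linear order of $V$ and $\sigma:E\to\{1,\dots,k\}$, such that there are no two edges $uv,wx$ with $\sigma(uv)=\sigma(wx)$ and $u\prec w\prec v\prec x$. A graph $G$ and a set of paths $\mathcal{P}$ are near-disjoint if the vertices that $G$ and the paths of $\mathcal{P}$ have in common are exactly the endpoints of these paths. For such $G$ and $\mathcal{P}$, $G\curlyvee\mathcal{P}$ denotes the graph obtained by inserting the paths of $\mathcal{P}$ into $G$ (the union of $G$ and the paths); $G\curlyvee P$ means $G\curlyvee\{P\}$. -}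

module Defs where

open import Level using (Level; 0ℓ) renaming (suc to lsuc)
open import Data.Nat using (ℕ; zero; suc; _≤_)
open import Data.Fin using (Fin)
open import Data.Product using (Σ; _×_; _,_; proj₁; proj₂; ∃-syntax)
open import Data.Sum using (_⊎_)
open import Data.List using (List; []; _∷_; _++_; [_]; length; lookup; take; drop)
open import Data.List.Membership.Propositional using (_∈_; _∉_)
open import Data.List.Relation.Unary.All using (All)
open import Data.List.Relation.Unary.Unique.Propositional using (Unique)
open import Data.List.Relation.Unary.AllPairs using (AllPairs)
open import Relation.Nullary using (¬_)
open import Relation.Binary.PropositionalEquality using (_≡_; _≢_)

-- Vertices are labelled by natural numbers; a graph is a list of
-- vertices and a list of edges (unordered pairs stored as ordered pairs).
record Graph : Set where
  constructor mkGraph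
  field
    V : List ℕ
    E : List (ℕ × ℕ)
open Graph public

SameEdge : ℕ × ℕ → ℕ × ℕ → Set
SameEdge (a , b) (c , d) = (a ≡ c × b ≡ d) ⊎ (a ≡ d × b ≡ c)

IsGraph : Graph → Set
IsGraph G =
  Unique (V G)
  × All (λ e → proj₁ e ∈ V G × proj₂ e ∈ V G × proj₁ e ≢ proj₂ e) (E G)
  × AllPairs (λ e f → ¬ SameEdge e f) (E G)

pathEdges : List ℕ → List (ℕ × ℕ)
pathEdges (x ∷ y ∷ r) = (x , y) ∷ pathEdges (y ∷ r)
pathEdges _ = []

-- A path given by its endpoints s, t and its list of interior vertices I;
-- its vertex sequence is s, I, t.
pathVertices : ℕ → List ℕ → ℕ → List ℕ
pathVertices s I t = s ∷ I ++ [ t ]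

IsPath : ℕ → List ℕ → ℕ → Set
IsPath s I t = Unique (pathVertices s I t)

NearDisjoint : Graph → ℕ → List ℕ → ℕ → Set
NearDisjoint G s I t =
  ∀ v → (v ∈ V G × v ∈ pathVertices s I t) ⇔' (v ≡ s ⊎ v ≡ t)
  where
  _⇔'_ : Set → Set → Set
  A ⇔' B = (A → B) × (B → A)

_⋎_ : Graph → (ℕ × List ℕ × ℕ) → Graph
G ⋎ (s , I , t) = mkGraph (V G ++ I) (E G ++ pathEdges (pathVertices s I t))

-- Subdividing the i-th edge (0 ≤ i ≤ length I) of the path s I t once by
-- a new vertex w: w is inserted between the i-th and (i+1)-st vertex of the
-- vertex sequence s, I, t.
subdivideInterior : ℕ → ℕ → List ℕ → List ℕ
subdivideInterior i w I = take i I ++ w ∷ drop i I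

Crosses : (ℕ → ℕ → Set) → ℕ × ℕ → ℕ × ℕ → Set
Crosses _≺_ e f =
  ∃[ u ] ∃[ v ] ∃[ w ] ∃[ x ]
    (SameEdge e (u , v) × SameEdge f (w , x) × u ≺ w × w ≺ v × v ≺ x)

record BookEmbedding (k : ℕ) (G : Graph) : Set₁ where
  field
    _≺_ : ℕ → ℕ → Set
    ≺-irrefl : ∀ {u} → u ∈ V G → ¬ (u ≺ u)
    ≺-trans : ∀ {u v w} → u ∈ V G → v ∈ V G → w ∈ V G → u ≺ v → v ≺ w → u ≺ w
    ≺-total : ∀ {u v} → u ∈ V G → v ∈ V G → u ≢ v → (u ≺ v) ⊎ (v ≺ u)
    σ : Fin (length (E G)) → Fin k
    noCrossing : ∀ i j → σ i ≡ σ j →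
      ¬ Crosses _≺_ (lookup (E G) i) (lookup (E G) j)

-- As P has an interior vertex, the subdivided edge ab has an interior end a,
-- of degree 2 in G ⋎ P with further neighbour c.  So G ⋎ P′ arises from
-- G ⋎ P by expanding a into the edge aw, where a keeps c and w takes over b;
-- conversely, merging w into a maps G ⋎ P′ onto G ⋎ P.  Put w immediately
-- next to a on the spine, on the side that makes c, a, w, b cyclically
-- ordered, the edge aw on any page and wb on the page of ab.  Every crossing
-- of the new drawing then maps to a crossing of the old one, except a
-- crossing of ac with wb, which the cyclic choice rules out.
module Submission where

open import Defs
open import Data.Nat using (ℕ; _≤_; s≤s; z≤n)
open import Data.Nat.Properties using (_≟_)
open import Data.Fin using (Fin)
open import Data.Product using (_×_; _,_; proj₁; proj₂; ∃-syntax)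
import Data.Product as Product
open import Data.Sum using (_⊎_; inj₁; inj₂)
import Data.Sum as Sum
open import Data.Empty using (⊥; ⊥-elim)
open import Data.List using (List; []; _∷_; _++_; [_]; length; lookup; take; drop)
open import Data.List.Properties using (++-assoc; take++drop≡id)
open import Data.List.Membership.Propositional using (_∈_; _∉_)
open import Data.List.Membership.Propositional.Properties using (∈-lookup; ∈-++⁺ˡ; ∈-++⁺ʳ; ∈-++⁻)
open import Data.List.Relation.Unary.Any using (here; there; index)
open import Data.List.Relation.Unary.Any.Properties using (lookup-index)
open import Data.List.Relation.Unary.All using (_∷_) renaming (lookup to All-lookup)
open import Data.List.Relation.Unary.All.Properties using (¬Any⇒All¬)
open import Data.List.Relation.Unary.Unique.Propositional using (Unique; _∷_)
open import Data.List.Relation.Unary.Unique.Propositional.Properties using (Unique[x∷xs]⇒x∉xs)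
open import Data.List.Relation.Binary.Permutation.Propositional using (_↭_; ↭-refl; ↭-sym; ↭⇒↭ₛ; prep; swap; trans)
open import Data.List.Relation.Binary.Permutation.Propositional.Properties using (shift; ∈-resp-↭; ++⁺ˡ; ++⁺ʳ)
open import Relation.Nullary using (¬_; yes; no)
open import Relation.Binary.PropositionalEquality
  using (_≡_; _≢_; refl; sym; subst; subst₂; ≢-sym; setoid)
  renaming (trans to ≡-trans)
open import Data.List.Relation.Binary.Permutation.Setoid.Properties (setoid ℕ) using (Unique-resp-↭)

-- Edges and paths as lists

SameEdge-swapʳ : ∀ {e₁ e₂ u v} → SameEdge (e₁ , e₂) (u , v) → SameEdge (e₁ , e₂) (v , u)
SameEdge-swapʳ = Sum.swap

SameEdge-map : ∀ (g : ℕ → ℕ) {e₁ e₂ u v} → SameEdge (e₁ , e₂) (u , v) → SameEdge (g e₁ , g e₂) (g u , g v)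
SameEdge-map g (inj₁ (refl , refl)) = inj₁ (refl , refl)
SameEdge-map g (inj₂ (refl , refl)) = inj₂ (refl , refl)

SameEdge-resp : ∀ {P : ℕ → Set} {e₁ e₂ u v} → P e₁ × P e₂ → SameEdge (e₁ , e₂) (u , v) → P u × P v
SameEdge-resp (p₁ , p₂) (inj₁ (refl , refl)) = p₁ , p₂
SameEdge-resp (p₁ , p₂) (inj₂ (refl , refl)) = p₂ , p₁

∈-∉⇒≢ : ∀ {x w} {xs : List ℕ} → x ∈ xs → w ∉ xs → x ≢ w
∈-∉⇒≢ x∈ w∉ refl = w∉ x∈

Unique-++⁻ʳ : ∀ (P : List ℕ) {R} → Unique (P ++ R) → Unique R
Unique-++⁻ʳ [] u = u
Unique-++⁻ʳ (_ ∷ P) (_ ∷ u) = Unique-++⁻ʳ P u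

Unique-++-[]⇒∉ : ∀ (I : List ℕ) {t} → Unique (I ++ [ t ]) → t ∉ I
Unique-++-[]⇒∉ (x ∷ I) (x∉ ∷ _) (here refl) = All-lookup x∉ (∈-++⁺ʳ I (here refl)) refl
Unique-++-[]⇒∉ (x ∷ I) (_ ∷ u) (there t∈) = Unique-++-[]⇒∉ I u t∈

pathEdges-⊆ : ∀ L {u v} → (u , v) ∈ pathEdges L → u ∈ L × v ∈ L
pathEdges-⊆ (x ∷ y ∷ r) (here refl) = here refl , there (here refl)
pathEdges-⊆ (x ∷ y ∷ r) (there m) = Product.map there there (pathEdges-⊆ (y ∷ r) m)

pathEdges-target : ∀ x r {u v} → (u , v) ∈ pathEdges (x ∷ r) → v ∈ r
pathEdges-target x (y ∷ r) (here refl) = here refl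
pathEdges-target x (y ∷ r) (there m) = there (pathEdges-target y r m)

pathEdges-++⁺ʳ : ∀ P {R : List ℕ} {e} → e ∈ pathEdges R → e ∈ pathEdges (P ++ R)
pathEdges-++⁺ʳ [] m = m
pathEdges-++⁺ʳ (p ∷ []) {r ∷ R} m = there m
pathEdges-++⁺ʳ (p ∷ q ∷ P) m = there (pathEdges-++⁺ʳ (q ∷ P) m)

pathEdges-successor : ∀ {L x y z} → Unique L →
  (x , y) ∈ pathEdges L → (x , z) ∈ pathEdges L → y ≡ z
pathEdges-successor {a ∷ b ∷ r} _ (here refl) (here refl) = refl
pathEdges-successor {a ∷ b ∷ r} u (here refl) (there m) =
  ⊥-elim (Unique[x∷xs]⇒x∉xs u (proj₁ (pathEdges-⊆ (b ∷ r) m)))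
pathEdges-successor {a ∷ b ∷ r} u (there m) (here refl) =
  ⊥-elim (Unique[x∷xs]⇒x∉xs u (proj₁ (pathEdges-⊆ (b ∷ r) m)))
pathEdges-successor {a ∷ b ∷ r} (_ ∷ u) (there m) (there m′) = pathEdges-successor u m m′

pathEdges-predecessor : ∀ {L x y z} → Unique L →
  (x , z) ∈ pathEdges L → (y , z) ∈ pathEdges L → x ≡ y
pathEdges-predecessor {a ∷ b ∷ r} _ (here refl) (here refl) = refl
pathEdges-predecessor {a ∷ b ∷ r} (_ ∷ u) (here refl) (there m) =
  ⊥-elim (Unique[x∷xs]⇒x∉xs u (pathEdges-target b r m))
pathEdges-predecessor {a ∷ b ∷ r} (_ ∷ u) (there m) (here refl) =
  ⊥-elim (Unique[x∷xs]⇒x∉xs u (pathEdges-target b r m))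
pathEdges-predecessor {a ∷ b ∷ r} (_ ∷ u) (there m) (there m′) = pathEdges-predecessor u m m′

pathEdges-neighbours : ∀ {L x y z} → Unique L →
  (y , x) ∈ pathEdges L → (x , z) ∈ pathEdges L →
  ∀ {e₁ e₂ r} → (e₁ , e₂) ∈ pathEdges L → SameEdge (e₁ , e₂) (x , r) → r ≡ y ⊎ r ≡ z
pathEdges-neighbours u yx xz m (inj₁ (refl , refl)) = inj₂ (pathEdges-successor u m xz)
pathEdges-neighbours u yx xz m (inj₂ (refl , refl)) = inj₁ (pathEdges-predecessor u m yx)

pathEdges-subdivide : ∀ P x w y Q {e} → e ∈ pathEdges (P ++ x ∷ w ∷ y ∷ Q) →
  e ∈ pathEdges (P ++ x ∷ y ∷ Q) ⊎ e ≡ (x , w) ⊎ e ≡ (w , y)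
pathEdges-subdivide [] x w y Q (here refl) = inj₂ (inj₁ refl)
pathEdges-subdivide [] x w y Q (there (here refl)) = inj₂ (inj₂ refl)
pathEdges-subdivide [] x w y Q (there (there m)) = inj₁ (there m)
pathEdges-subdivide (p ∷ []) x w y Q (here refl) = inj₁ (here refl)
pathEdges-subdivide (p ∷ []) x w y Q (there m) =
  Sum.map₁ there (pathEdges-subdivide [] x w y Q m)
pathEdges-subdivide (p ∷ q ∷ P) x w y Q (here refl) = inj₁ (here refl)
pathEdges-subdivide (p ∷ q ∷ P) x w y Q (there m) =
  Sum.map₁ there (pathEdges-subdivide (q ∷ P) x w y Q m)

pathEdges-nonempty : ∀ s R t → ∃[ e ] e ∈ pathEdges (pathVertices s R t)
pathEdges-nonempty s [] t = (s , t) , here refl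
pathEdges-nonempty s (r ∷ R) t = (s , r) , here refl

-- Subdividing a path next to an interior vertex

merge : ℕ → ℕ → ℕ → ℕ
merge w a x with x ≟ w
... | yes _ = a
... | no _ = x

merge-≡ : ∀ w a → merge w a w ≡ a
merge-≡ w a with w ≟ w
... | yes _ = refl
... | no w≢w = ⊥-elim (w≢w refl)

merge-≢ : ∀ {w a x} → x ≢ w → merge w a x ≡ x
merge-≢ {w} {a} {x} x≢w with x ≟ w
... | yes x≡w = ⊥-elim (x≢w x≡w)
... | no _ = refl

merge-injective : ∀ {w a x y} → merge w a x ≡ merge w a y → x ≡ y ⊎ SameEdge (x , y) (a , w)
merge-injective {w} {a} {x} {y} eq with x ≟ w | y ≟ w
... | yes x≡w | yes y≡w = inj₁ (≡-trans x≡w (sym y≡w))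
... | yes x≡w | no _ = inj₂ (inj₂ (x≡w , sym eq))
... | no _ | yes y≡w = inj₂ (inj₁ (eq , y≡w))
... | no _ | no _ = inj₁ eq

merge-preserves-≢ : ∀ {w a x y} → x ≢ w → y ≢ w → x ≢ y → merge w a x ≢ merge w a y
merge-preserves-≢ x≢w y≢w x≢y eq = x≢y (≡-trans (sym (merge-≢ x≢w)) (≡-trans eq (merge-≢ y≢w)))

merge-∈ : ∀ {w a x} {xs : List ℕ} → a ∈ xs → w ∉ xs → x ∈ w ∷ xs → merge w a x ∈ xs
merge-∈ {w} {a} a∈ w∉ (here refl) = subst (_∈ _) (sym (merge-≡ w a)) a∈
merge-∈ a∈ w∉ (there x∈) = subst (_∈ _) (sym (merge-≢ (∈-∉⇒≢ x∈ w∉))) x∈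

merge-∈-edges : ∀ {w a e₁ e₂} {es : List (ℕ × ℕ)} → e₁ ≢ w → e₂ ≢ w →
  (e₁ , e₂) ∈ es → (merge w a e₁ , merge w a e₂) ∈ es
merge-∈-edges e₁≢w e₂≢w = subst₂ (λ p q → (p , q) ∈ _) (sym (merge-≢ e₁≢w)) (sym (merge-≢ e₂≢w))

merge-∈-pathEdges : ∀ {w a e₁ e₂ L} → w ∉ L →
  (e₁ , e₂) ∈ pathEdges L → (merge w a e₁ , merge w a e₂) ∈ pathEdges L
merge-∈-pathEdges {L = L} w∉L m =
  merge-∈-edges (∈-∉⇒≢ (proj₁ (pathEdges-⊆ L m)) w∉L) (∈-∉⇒≢ (proj₂ (pathEdges-⊆ L m)) w∉L) m

-- L′ is L with w inserted next to a, between a and its neighbour b; c is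
-- the other neighbour of a.
data Window (w a : ℕ) : List ℕ → List ℕ → Set where
  after : ∀ P c b Q → Window w a (P ++ c ∷ a ∷ b ∷ Q) (P ++ c ∷ a ∷ w ∷ b ∷ Q)
  before : ∀ P b c Q → Window w a (P ++ b ∷ a ∷ c ∷ Q) (P ++ b ∷ w ∷ a ∷ c ∷ Q)

Window-∷ : ∀ {w a L L′} s → Window w a L L′ → Window w a (s ∷ L) (s ∷ L′)
Window-∷ s (after P c b Q) = after (s ∷ P) c b Q
Window-∷ s (before P b c Q) = before (s ∷ P) b c Q

window : ∀ {w} s X Y t → 1 ≤ length (X ++ Y) →
  ∃[ a ] a ∈ X ++ Y × Window w a (pathVertices s (X ++ Y) t) (pathVertices s (X ++ w ∷ Y) t)
window s [] (a ∷ []) t _ = a , here refl , before [] s t []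
window s [] (a ∷ c ∷ Y) t _ = a , here refl , before [] s c (Y ++ [ t ])
window s (a ∷ []) [] t _ = a , here refl , after [] s t []
window s (a ∷ []) (b ∷ Y) t _ = a , here refl , after [] s b (Y ++ [ t ])
window s (x ∷ x′ ∷ X) Y t _ with window x (x′ ∷ X) Y t (s≤s z≤n)
... | a , a∈ , W = a , there a∈ , Window-∷ s W

record Subdivision (w a : ℕ) (L L′ : List ℕ) : Set where
  field
    b c : ℕ
    b∈L : b ∈ L
    c∈L : c ∈ L
    c≢a : c ≢ a
    b≢a : b ≢ a
    c≢b : c ≢ b
    a-neighbours : ∀ {e₁ e₂ z} → (e₁ , e₂) ∈ pathEdges L′ → SameEdge (e₁ , e₂) (a , z) → z ≡ w ⊎ z ≡ c
    w-neighbours : ∀ {e₁ e₂ z} → (e₁ , e₂) ∈ pathEdges L′ → SameEdge (e₁ , e₂) (w , z) → z ≡ a ⊎ z ≡ b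
    merge-edges : ∀ {e₁ e₂} → (e₁ , e₂) ∈ pathEdges L′ →
      (merge w a e₁ , merge w a e₂) ∈ pathEdges L ⊎ SameEdge (e₁ , e₂) (a , w)

subdivision : ∀ {w a L L′} → Unique L′ → w ∉ L → Window w a L L′ → Subdivision w a L L′
subdivision {w} {a} uL′ w∉L (after P c b Q) = record
  { b = b
  ; c = c
  ; b∈L = b∈L
  ; c∈L = ∈-++⁺ʳ P (here refl)
  ; c≢a = proj₁ (distinct (Unique-++⁻ʳ P uL′))
  ; b≢a = proj₁ (proj₂ (distinct (Unique-++⁻ʳ P uL′)))
  ; c≢b = proj₂ (proj₂ (distinct (Unique-++⁻ʳ P uL′)))
  ; a-neighbours = λ m S → Sum.swap (pathEdges-neighbours uL′ ca aw m S)
  ; w-neighbours = pathEdges-neighbours uL′ aw wb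
  ; merge-edges = merge-edges
  }
  where
  b∈L : b ∈ P ++ c ∷ a ∷ b ∷ Q
  b∈L = ∈-++⁺ʳ P (there (there (here refl)))

  ca : (c , a) ∈ pathEdges (P ++ c ∷ a ∷ w ∷ b ∷ Q)
  ca = pathEdges-++⁺ʳ P (here refl)

  aw : (a , w) ∈ pathEdges (P ++ c ∷ a ∷ w ∷ b ∷ Q)
  aw = pathEdges-++⁺ʳ P (there (here refl))

  wb : (w , b) ∈ pathEdges (P ++ c ∷ a ∷ w ∷ b ∷ Q)
  wb = pathEdges-++⁺ʳ P (there (there (here refl)))

  distinct : Unique (c ∷ a ∷ w ∷ b ∷ Q) → c ≢ a × b ≢ a × c ≢ b
  distinct ((c≢a ∷ _ ∷ c≢b ∷ _) ∷ (_ ∷ a≢b ∷ _) ∷ _) = c≢a , ≢-sym a≢b , c≢b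

  reassoc : ∀ R → P ++ c ∷ R ≡ (P ++ [ c ]) ++ R
  reassoc R = sym (++-assoc P [ c ] R)

  merge-edges : ∀ {e₁ e₂} → (e₁ , e₂) ∈ pathEdges (P ++ c ∷ a ∷ w ∷ b ∷ Q) →
    (merge w a e₁ , merge w a e₂) ∈ pathEdges (P ++ c ∷ a ∷ b ∷ Q) ⊎ SameEdge (e₁ , e₂) (a , w)
  merge-edges m with pathEdges-subdivide (P ++ [ c ]) a w b Q (subst (λ L → _ ∈ pathEdges L) (reassoc _) m)
  ... | inj₁ m′ = inj₁ (merge-∈-pathEdges w∉L (subst (λ L → _ ∈ pathEdges L) (sym (reassoc _)) m′))
  ... | inj₂ (inj₁ refl) = inj₂ (inj₁ (refl , refl))
  ... | inj₂ (inj₂ refl) = inj₁ (subst₂ (λ p q → (p , q) ∈ _) (sym (merge-≡ w a)) (sym (merge-≢ (∈-∉⇒≢ b∈L w∉L)))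
                                   (pathEdges-++⁺ʳ P (there (here refl))))
subdivision {w} {a} uL′ w∉L (before P b c Q) = record
  { b = b
  ; c = c
  ; b∈L = b∈L
  ; c∈L = ∈-++⁺ʳ P (there (there (here refl)))
  ; c≢a = proj₁ (distinct (Unique-++⁻ʳ P uL′))
  ; b≢a = proj₁ (proj₂ (distinct (Unique-++⁻ʳ P uL′)))
  ; c≢b = proj₂ (proj₂ (distinct (Unique-++⁻ʳ P uL′)))
  ; a-neighbours = pathEdges-neighbours uL′ wa ac
  ; w-neighbours = λ m S → Sum.swap (pathEdges-neighbours uL′ bw wa m S)
  ; merge-edges = merge-edges
  }
  where
  b∈L : b ∈ P ++ b ∷ a ∷ c ∷ Q
  b∈L = ∈-++⁺ʳ P (here refl)

  bw : (b , w) ∈ pathEdges (P ++ b ∷ w ∷ a ∷ c ∷ Q)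
  bw = pathEdges-++⁺ʳ P (here refl)

  wa : (w , a) ∈ pathEdges (P ++ b ∷ w ∷ a ∷ c ∷ Q)
  wa = pathEdges-++⁺ʳ P (there (here refl))

  ac : (a , c) ∈ pathEdges (P ++ b ∷ w ∷ a ∷ c ∷ Q)
  ac = pathEdges-++⁺ʳ P (there (there (here refl)))

  distinct : Unique (b ∷ w ∷ a ∷ c ∷ Q) → c ≢ a × b ≢ a × c ≢ b
  distinct ((_ ∷ b≢a ∷ b≢c ∷ _) ∷ _ ∷ (a≢c ∷ _) ∷ _) = ≢-sym a≢c , b≢a , ≢-sym b≢c

  merge-edges : ∀ {e₁ e₂} → (e₁ , e₂) ∈ pathEdges (P ++ b ∷ w ∷ a ∷ c ∷ Q) →
    (merge w a e₁ , merge w a e₂) ∈ pathEdges (P ++ b ∷ a ∷ c ∷ Q) ⊎ SameEdge (e₁ , e₂) (a , w)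
  merge-edges m with pathEdges-subdivide P b w a (c ∷ Q) m
  ... | inj₁ m′ = inj₁ (merge-∈-pathEdges w∉L m′)
  ... | inj₂ (inj₁ refl) = inj₁ (subst₂ (λ p q → (p , q) ∈ _) (sym (merge-≢ (∈-∉⇒≢ b∈L w∉L))) (sym (merge-≡ w a))
                                   (pathEdges-++⁺ʳ P (here refl)))
  ... | inj₂ (inj₂ refl) = inj₂ (inj₂ (refl , refl))

-- Expanding a vertex of a book embedding into an edge

data Cyclic (_<_ : ℕ → ℕ → Set) (x y z : ℕ) : Set where
  cyclic₀ : x < y → y < z → Cyclic _<_ x y z
  cyclic₁ : y < z → z < x → Cyclic _<_ x y z
  cyclic₂ : z < x → x < y → Cyclic _<_ x y z

Cyclic-rotate : ∀ {R x y z} → Cyclic R x y z → Cyclic R y z x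
Cyclic-rotate (cyclic₀ x<y y<z) = cyclic₂ x<y y<z
Cyclic-rotate (cyclic₁ y<z z<x) = cyclic₀ y<z z<x
Cyclic-rotate (cyclic₂ z<x x<y) = cyclic₁ z<x x<y

module SpineOrder {k H} (B : BookEmbedding k H) where
  open BookEmbedding B

  ≺⇒≢ : ∀ {x y} → x ∈ V H → x ≺ y → x ≢ y
  ≺⇒≢ x∈ x≺y refl = ≺-irrefl x∈ x≺y

  ≺-asym : ∀ {x y} → x ∈ V H → y ∈ V H → x ≺ y → ¬ (y ≺ x)
  ≺-asym x∈ y∈ x≺y y≺x = ≺-irrefl x∈ (≺-trans x∈ y∈ x∈ x≺y y≺x)

  ordered⇒¬reverse : ∀ {x y z} → x ∈ V H → y ∈ V H → z ∈ V H →
    x ≺ y → y ≺ z → ¬ Cyclic _≺_ z y x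
  ordered⇒¬reverse x∈ y∈ z∈ x≺y y≺z (cyclic₀ z≺y _) = ≺-asym y∈ z∈ y≺z z≺y
  ordered⇒¬reverse x∈ y∈ z∈ x≺y y≺z (cyclic₁ y≺x _) = ≺-asym x∈ y∈ x≺y y≺x
  ordered⇒¬reverse x∈ y∈ z∈ x≺y y≺z (cyclic₂ _ z≺y) = ≺-asym y∈ z∈ y≺z z≺y

  module _ {x y z} (x∈ : x ∈ V H) (y∈ : y ∈ V H) (z∈ : z ∈ V H) where

    Cyclic⇒¬reverse : Cyclic _≺_ x y z → ¬ Cyclic _≺_ z y x
    Cyclic⇒¬reverse (cyclic₀ x≺y y≺z) rev =
      ordered⇒¬reverse x∈ y∈ z∈ x≺y y≺z rev
    Cyclic⇒¬reverse (cyclic₁ y≺z z≺x) rev =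
      ordered⇒¬reverse y∈ z∈ x∈ y≺z z≺x (Cyclic-rotate (Cyclic-rotate rev))
    Cyclic⇒¬reverse (cyclic₂ z≺x x≺y) rev =
      ordered⇒¬reverse z∈ x∈ y∈ z≺x x≺y (Cyclic-rotate rev)

    Cyclic-or-reverse : x ≢ y → y ≢ z → x ≢ z → Cyclic _≺_ x y z ⊎ Cyclic _≺_ z y x
    Cyclic-or-reverse x≢y y≢z x≢z
      with ≺-total x∈ y∈ x≢y | ≺-total y∈ z∈ y≢z | ≺-total x∈ z∈ x≢z
    ... | inj₁ x≺y | inj₁ y≺z | _ = inj₁ (cyclic₀ x≺y y≺z)
    ... | inj₂ y≺x | inj₂ z≺y | _ = inj₂ (cyclic₀ z≺y y≺x)
    ... | inj₁ x≺y | inj₂ z≺y | inj₁ x≺z = inj₂ (cyclic₂ x≺z z≺y)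
    ... | inj₁ x≺y | inj₂ z≺y | inj₂ z≺x = inj₁ (cyclic₂ z≺x x≺y)
    ... | inj₂ y≺x | inj₁ y≺z | inj₁ x≺z = inj₂ (cyclic₁ y≺x x≺z)
    ... | inj₂ y≺x | inj₁ y≺z | inj₂ z≺x = inj₁ (cyclic₁ y≺z z≺x)

-- H arises from H′ by contracting the edge uv via f, where u and v have the
-- single further neighbours pu and pv.
record EdgeContraction (H′ H : Graph) : Set where
  field
    f : ℕ → ℕ
    u v pu pv : ℕ
    u≢v : u ≢ v
    f-merges : f u ≡ f v
    f-injective : ∀ {x y} → f x ≡ f y → x ≡ y ⊎ SameEdge (x , y) (u , v)
    f-vertex : ∀ {x} → x ∈ V H′ → f x ∈ V H
    endpoints : ∀ {e₁ e₂} → (e₁ , e₂) ∈ E H′ → e₁ ∈ V H′ × e₂ ∈ V H′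
    f-edge : ∀ {e₁ e₂} → (e₁ , e₂) ∈ E H′ → (f e₁ , f e₂) ∈ E H ⊎ SameEdge (e₁ , e₂) (u , v)
    u-neighbours : ∀ {e₁ e₂ z} → (e₁ , e₂) ∈ E H′ → SameEdge (e₁ , e₂) (u , z) → z ≡ v ⊎ z ≡ pu
    v-neighbours : ∀ {e₁ e₂ z} → (e₁ , e₂) ∈ E H′ → SameEdge (e₁ , e₂) (v , z) → z ≡ u ⊎ z ≡ pv
    f-u∈ : f u ∈ V H
    f-pu∈ : f pu ∈ V H
    f-pv∈ : f pv ∈ V H
    f-pu≢f-u : f pu ≢ f u
    f-pv≢f-u : f pv ≢ f u
    f-pu≢f-pv : f pu ≢ f pv

swapEnds : ∀ {H′ H} → EdgeContraction H′ H → EdgeContraction H′ H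
swapEnds {H = H} C = record
  { f = f ; u = v ; v = u ; pu = pv ; pv = pu
  ; u≢v = ≢-sym u≢v
  ; f-merges = sym f-merges
  ; f-injective = λ eq → Sum.map₂ SameEdge-swapʳ (f-injective eq)
  ; f-vertex = f-vertex
  ; endpoints = endpoints
  ; f-edge = λ m → Sum.map₂ SameEdge-swapʳ (f-edge m)
  ; u-neighbours = v-neighbours
  ; v-neighbours = u-neighbours
  ; f-u∈ = subst (_∈ V H) f-merges f-u∈
  ; f-pu∈ = f-pv∈
  ; f-pv∈ = f-pu∈
  ; f-pu≢f-u = subst (f pv ≢_) f-merges f-pv≢f-u
  ; f-pv≢f-u = subst (f pu ≢_) f-merges f-pu≢f-u
  ; f-pu≢f-pv = ≢-sym f-pu≢f-pv
  }
  where open EdgeContraction C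

module OrientedExpansion {k H′ H} (B : BookEmbedding k H) (page : Fin k) (C : EdgeContraction H′ H) where
  open BookEmbedding B
  open EdgeContraction C
  open SpineOrder B

  -- v is inserted immediately after u: f orders everything else.
  _≺′_ : ℕ → ℕ → Set
  x ≺′ y = f x ≺ f y ⊎ (x ≡ u × y ≡ v)

  ≺′-irrefl : ∀ {x} → x ∈ V H′ → ¬ (x ≺′ x)
  ≺′-irrefl x∈ (inj₁ fx≺fx) = ≺-irrefl (f-vertex x∈) fx≺fx
  ≺′-irrefl x∈ (inj₂ (refl , u≡v)) = u≢v u≡v

  ≺′-trans : ∀ {x y z} → x ∈ V H′ → y ∈ V H′ → z ∈ V H′ → x ≺′ y → y ≺′ z → x ≺′ z
  ≺′-trans x∈ y∈ z∈ (inj₁ r) (inj₁ r′) = inj₁ (≺-trans (f-vertex x∈) (f-vertex y∈) (f-vertex z∈) r r′)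
  ≺′-trans {x} x∈ y∈ z∈ (inj₁ r) (inj₂ (refl , refl)) = inj₁ (subst (f x ≺_) f-merges r)
  ≺′-trans {z = z} x∈ y∈ z∈ (inj₂ (refl , refl)) (inj₁ r′) = inj₁ (subst (_≺ f z) (sym f-merges) r′)
  ≺′-trans x∈ y∈ z∈ (inj₂ (refl , refl)) (inj₂ (v≡u , _)) = ⊥-elim (u≢v (sym v≡u))

  ≺′-total : ∀ {x y} → x ∈ V H′ → y ∈ V H′ → x ≢ y → x ≺′ y ⊎ y ≺′ x
  ≺′-total {x} {y} x∈ y∈ x≢y with f x ≟ f y
  ... | no fx≢fy = Sum.map inj₁ inj₁ (≺-total (f-vertex x∈) (f-vertex y∈) fx≢fy)
  ... | yes fx≡fy with f-injective fx≡fy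
  ...   | inj₁ x≡y = ⊥-elim (x≢y x≡y)
  ...   | inj₂ (inj₁ (x≡u , y≡v)) = inj₁ (inj₂ (x≡u , y≡v))
  ...   | inj₂ (inj₂ (x≡v , y≡u)) = inj₂ (inj₂ (y≡u , x≡v))

  -- the contracted edge uv goes on an arbitrary page; it is never crossed
  pageOf : ∀ {e₁ e₂} → (f e₁ , f e₂) ∈ E H ⊎ SameEdge (e₁ , e₂) (u , v) → Fin k
  pageOf (inj₁ m) = σ (index m)
  pageOf (inj₂ _) = page

  σ′ : Fin (length (E H′)) → Fin k
  σ′ i = pageOf (f-edge (∈-lookup i))

  f-ends : ∀ {e₁ e₂ x y} → (e₁ , e₂) ∈ E H′ → SameEdge (e₁ , e₂) (x , y) → f x ∈ V H × f y ∈ V H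
  f-ends m = SameEdge-resp (Product.map f-vertex f-vertex (endpoints m))

  f-collapses : ∀ {e₁ e₂ x y} → SameEdge (e₁ , e₂) (u , v) → SameEdge (e₁ , e₂) (x , y) → f x ≡ f y
  f-collapses (inj₁ (refl , refl)) (inj₁ (refl , refl)) = f-merges
  f-collapses (inj₁ (refl , refl)) (inj₂ (refl , refl)) = sym f-merges
  f-collapses (inj₂ (refl , refl)) (inj₁ (refl , refl)) = sym f-merges
  f-collapses (inj₂ (refl , refl)) (inj₂ (refl , refl)) = f-merges

  other-end-of-u : ∀ {e₁ e₂ z} → (e₁ , e₂) ∈ E H′ → SameEdge (e₁ , e₂) (u , z) → f z ≢ f u → z ≡ pu
  other-end-of-u m S fz≢fu with u-neighbours m S
  ... | inj₁ refl = ⊥-elim (fz≢fu (sym f-merges))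
  ... | inj₂ z≡pu = z≡pu

  other-end-of-v : ∀ {e₁ e₂ z} → (e₁ , e₂) ∈ E H′ → SameEdge (e₁ , e₂) (v , z) → f z ≢ f u → z ≡ pv
  other-end-of-v m S fz≢fu with v-neighbours m S
  ... | inj₁ refl = ⊥-elim (fz≢fu refl)
  ... | inj₂ z≡pv = z≡pv

  image-crossing-absurd : ∀ {e₁ e₂ e₁′ e₂′ x y x′ y′}
    (c : (f e₁ , f e₂) ∈ E H ⊎ SameEdge (e₁ , e₂) (u , v))
    (c′ : (f e₁′ , f e₂′) ∈ E H ⊎ SameEdge (e₁′ , e₂′) (u , v)) → pageOf c ≡ pageOf c′ →
    f x ∈ V H × f y ∈ V H → f x′ ∈ V H × f y′ ∈ V H →
    SameEdge (e₁ , e₂) (x , y) → SameEdge (e₁′ , e₂′) (x′ , y′) →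
    f x ≺ f x′ → f x′ ≺ f y → f y ≺ f y′ → ⊥
  image-crossing-absurd {x = x} {y} {x′} {y′} (inj₁ m) (inj₁ m′) same _ _ S S′ r₁ r₂ r₃ =
    noCrossing (index m) (index m′) same
      (f x , f y , f x′ , f y′ , lift m S , lift m′ S′ , r₁ , r₂ , r₃)
    where
    lift : ∀ {e₁ e₂ a b} (m : (f e₁ , f e₂) ∈ E H) → SameEdge (e₁ , e₂) (a , b) →
           SameEdge (lookup (E H) (index m)) (f a , f b)
    lift m S = subst (λ e → SameEdge e _) (lookup-index m) (SameEdge-map f S)
  image-crossing-absurd {x = x} (inj₂ uv) _ _ (fx∈ , fy∈) (fx′∈ , _) S _ r₁ r₂ _ =
    ≺-irrefl fx∈ (subst (f x ≺_) (sym (f-collapses uv S)) (≺-trans fx∈ fx′∈ fy∈ r₁ r₂))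
  image-crossing-absurd {x′ = x′} (inj₁ _) (inj₂ uv) _ (_ , fy∈) (fx′∈ , fy′∈) _ S′ _ r₂ r₃ =
    ≺-irrefl fx′∈ (subst (f x′ ≺_) (sym (f-collapses uv S′)) (≺-trans fx′∈ fy∈ fy′∈ r₂ r₃))

  module _ (orientation : Cyclic _≺_ (f pu) (f u) (f pv)) where

    reverse-absurd : ¬ Cyclic _≺_ (f pv) (f u) (f pu)
    reverse-absurd = Cyclic⇒¬reverse f-pu∈ f-u∈ f-pv∈ orientation

    -- A crossing that uses the adjacency u ≺′ v pairs an edge at u with an
    -- edge at v, i.e. u pu with v pv, and forces f pv, f u, f pu into cyclic order.
    crossing-absurd : ∀ {e₁ e₂ e₁′ e₂′ x y x′ y′}
      (m : (e₁ , e₂) ∈ E H′) (m′ : (e₁′ , e₂′) ∈ E H′) → pageOf (f-edge m) ≡ pageOf (f-edge m′) →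
      SameEdge (e₁ , e₂) (x , y) → SameEdge (e₁′ , e₂′) (x′ , y′) →
      x ≺′ x′ → x′ ≺′ y → y ≺′ y′ → ⊥
    crossing-absurd m m′ same S S′ (inj₁ r₁) (inj₁ r₂) (inj₁ r₃) =
      image-crossing-absurd (f-edge m) (f-edge m′) same (f-ends m S) (f-ends m′ S′) S S′ r₁ r₂ r₃
    crossing-absurd _ _ _ _ _ (inj₂ (refl , refl)) (inj₂ (v≡u , _)) _ = u≢v (sym v≡u)
    crossing-absurd _ _ _ _ _ _ (inj₂ (refl , refl)) (inj₂ (v≡u , _)) = u≢v (sym v≡u)
    crossing-absurd _ _ _ _ _ (inj₂ (refl , refl)) (inj₁ r₂) (inj₂ (refl , refl)) =
      ≺-irrefl f-u∈ (subst (_≺ f u) (sym f-merges) r₂)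
    crossing-absurd {y = y} {y′ = y′} m m′ _ S S′ (inj₂ (refl , refl)) (inj₁ r₂) (inj₁ r₃) =
      reverse-absurd (subst₂ (λ p q → Cyclic _≺_ (f q) (f u) (f p)) y≡pu y′≡pv (cyclic₁ fu≺fy r₃))
      where
      fu≺fy : f u ≺ f y
      fu≺fy = subst (_≺ f y) (sym f-merges) r₂
      y≡pu : y ≡ pu
      y≡pu = other-end-of-u m S (≢-sym (≺⇒≢ f-u∈ fu≺fy))
      y′≡pv : y′ ≡ pv
      y′≡pv = other-end-of-v m′ S′ (λ eq → ≺-asym f-u∈ (proj₂ (f-ends m S)) fu≺fy (subst (f y ≺_) eq r₃))
    crossing-absurd {x = x} {y′ = y′} m m′ _ S S′ (inj₁ r₁) (inj₂ (refl , refl)) (inj₁ r₃) =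
      reverse-absurd (subst₂ (λ p q → Cyclic _≺_ (f p) (f u) (f q)) x≡pv y′≡pu (cyclic₀ r₁ fu≺fy′))
      where
      fu≺fy′ : f u ≺ f y′
      fu≺fy′ = subst (_≺ f y′) (sym f-merges) r₃
      x≡pv : x ≡ pv
      x≡pv = other-end-of-v m (SameEdge-swapʳ S) (≺⇒≢ (proj₁ (f-ends m S)) r₁)
      y′≡pu : y′ ≡ pu
      y′≡pu = other-end-of-u m′ S′ (≢-sym (≺⇒≢ f-u∈ fu≺fy′))
    crossing-absurd {x = x} {x′ = x′} m m′ _ S S′ (inj₁ r₁) (inj₁ r₂) (inj₂ (refl , refl)) =
      reverse-absurd (subst₂ (λ p q → Cyclic _≺_ (f q) (f u) (f p)) x≡pu x′≡pv (cyclic₂ r₁ r₂))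
      where
      fx′∈ : f x′ ∈ V H
      fx′∈ = proj₁ (f-ends m′ S′)
      x≡pu : x ≡ pu
      x≡pu = other-end-of-u m (SameEdge-swapʳ S) (λ eq → ≺-asym fx′∈ f-u∈ r₂ (subst (_≺ f x′) eq r₁))
      x′≡pv : x′ ≡ pv
      x′≡pv = other-end-of-v m′ (SameEdge-swapʳ S′) (≺⇒≢ fx′∈ r₂)

    embedding : BookEmbedding k H′
    embedding = record
      { _≺_ = _≺′_
      ; ≺-irrefl = ≺′-irrefl
      ; ≺-trans = ≺′-trans
      ; ≺-total = ≺′-total
      ; σ = σ′
      ; noCrossing = λ i j same (_ , _ , _ , _ , S , S′ , r₁ , r₂ , r₃) →
          crossing-absurd (∈-lookup {xs = E H′} i) (∈-lookup {xs = E H′} j) same S S′ r₁ r₂ r₃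
      }

module _ {k H′ H} (B : BookEmbedding k H) (page : Fin k) (C : EdgeContraction H′ H) where
  open BookEmbedding B using (_≺_)
  open EdgeContraction C
  open SpineOrder B using (Cyclic-or-reverse)

  expandEmbedding : BookEmbedding k H′
  expandEmbedding with Cyclic-or-reverse f-pu∈ f-u∈ f-pv∈ f-pu≢f-u (≢-sym f-pv≢f-u) f-pu≢f-pv
  ... | inj₁ cyclic = OrientedExpansion.embedding B page C cyclic
  ... | inj₂ reverse = OrientedExpansion.embedding B page (swapEnds C)
                         (subst (λ A → Cyclic _≺_ (f pv) A (f pu)) f-merges reverse)

-- Inserting the subdivided path into G

interior-∉-V : ∀ {G s t I a} → IsPath s I t → NearDisjoint G s I t → a ∈ I → a ∉ V G
interior-∉-V {I = I} (s∉ ∷ u) nd a∈I a∈G with proj₁ (nd _) (a∈G , there (∈-++⁺ˡ a∈I))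
... | inj₁ refl = All-lookup s∉ (∈-++⁺ˡ a∈I) refl
... | inj₂ refl = Unique-++-[]⇒∉ I u a∈I

module PathInsertion {G : Graph} {s t : ℕ} (isGraph : IsGraph G) (s∈G : s ∈ V G) (t∈G : t ∈ V G) where

  pathVertices-⊆ : ∀ R {x} → x ∈ pathVertices s R t → x ∈ V (G ⋎ (s , R , t))
  pathVertices-⊆ R (here refl) = ∈-++⁺ˡ s∈G
  pathVertices-⊆ R (there x∈) with ∈-++⁻ R x∈
  ... | inj₁ x∈R = ∈-++⁺ʳ (V G) x∈R
  ... | inj₂ (here refl) = ∈-++⁺ˡ t∈G

  G-endpoints : ∀ {e₁ e₂} → (e₁ , e₂) ∈ E G → e₁ ∈ V G × e₂ ∈ V G
  G-endpoints m = Product.map₂ proj₁ (All-lookup (proj₁ (proj₂ isGraph)) m)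

  ⋎-endpoints : ∀ R {e₁ e₂} → (e₁ , e₂) ∈ E (G ⋎ (s , R , t)) →
    e₁ ∈ V (G ⋎ (s , R , t)) × e₂ ∈ V (G ⋎ (s , R , t))
  ⋎-endpoints R m with ∈-++⁻ (E G) m
  ... | inj₁ mG = Product.map ∈-++⁺ˡ ∈-++⁺ˡ (G-endpoints mG)
  ... | inj₂ mP = Product.map (pathVertices-⊆ R) (pathVertices-⊆ R) (pathEdges-⊆ _ mP)

  ⋎-edges-off-G : ∀ R {x e₁ e₂ z} → x ∉ V G → (e₁ , e₂) ∈ E (G ⋎ (s , R , t)) →
    SameEdge (e₁ , e₂) (x , z) → (e₁ , e₂) ∈ pathEdges (pathVertices s R t)
  ⋎-edges-off-G R x∉G m S with ∈-++⁻ (E G) m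
  ... | inj₁ mG = ⊥-elim (x∉G (proj₁ (SameEdge-resp (G-endpoints mG) S)))
  ... | inj₂ mP = mP

module SubdividedPath {G : Graph} {s t w : ℕ} (X Y : List ℕ)
  (isGraph : IsGraph G) (path : IsPath s (X ++ Y) t) (nd : NearDisjoint G s (X ++ Y) t)
  (w∉G : w ∉ V G) (w∉P : w ∉ pathVertices s (X ++ Y) t) where

  s∈G : s ∈ V G
  s∈G = proj₁ (proj₂ (nd s) (inj₁ refl))

  t∈G : t ∈ V G
  t∈G = proj₁ (proj₂ (nd t) (inj₂ refl))

  open PathInsertion isGraph s∈G t∈G

  w∉H : w ∉ V G ++ (X ++ Y)
  w∉H w∈ with ∈-++⁻ (V G) w∈
  ... | inj₁ w∈G = w∉G w∈G
  ... | inj₂ w∈I = w∉P (there (∈-++⁺ˡ w∈I))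

  vertices-↭ : V G ++ (X ++ w ∷ Y) ↭ w ∷ V G ++ (X ++ Y)
  vertices-↭ = trans (++⁺ˡ (V G) (shift w X Y)) (shift w (V G) (X ++ Y))

  pathVertices-↭ : pathVertices s (X ++ w ∷ Y) t ↭ w ∷ pathVertices s (X ++ Y) t
  pathVertices-↭ = trans (prep s (++⁺ʳ [ t ] (shift w X Y))) (swap s w ↭-refl)

  subdivided-unique : Unique (pathVertices s (X ++ w ∷ Y) t)
  subdivided-unique = Unique-resp-↭ (↭⇒↭ₛ (↭-sym pathVertices-↭)) (¬Any⇒All¬ _ w∉P ∷ path)

  contraction : ∀ {a} → a ∈ X ++ Y →
    Subdivision w a (pathVertices s (X ++ Y) t) (pathVertices s (X ++ w ∷ Y) t) →
    EdgeContraction (G ⋎ (s , X ++ w ∷ Y , t)) (G ⋎ (s , X ++ Y , t))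
  contraction {a} a∈I sub = record
    { f = merge w a
    ; u = a
    ; v = w
    ; pu = c
    ; pv = b
    ; u≢v = a≢w
    ; f-merges = ≡-trans (merge-≢ a≢w) (sym (merge-≡ w a))
    ; f-injective = merge-injective
    ; f-vertex = λ x∈ → merge-into-H (∈-resp-↭ vertices-↭ x∈)
    ; endpoints = ⋎-endpoints (X ++ w ∷ Y)
    ; f-edge = f-edge
    ; u-neighbours = λ m S → a-neighbours (⋎-edges-off-G _ (interior-∉-V {G = G} path nd a∈I) m S) S
    ; v-neighbours = λ m S → w-neighbours (⋎-edges-off-G _ w∉G m S) S
    ; f-u∈ = merge-into-H (there a∈H)
    ; f-pu∈ = merge-into-H (there (pathVertices-⊆ _ c∈L))
    ; f-pv∈ = merge-into-H (there (pathVertices-⊆ _ b∈L))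
    ; f-pu≢f-u = merge-preserves-≢ (≢w c∈L) a≢w c≢a
    ; f-pv≢f-u = merge-preserves-≢ (≢w b∈L) a≢w b≢a
    ; f-pu≢f-pv = merge-preserves-≢ (≢w c∈L) (≢w b∈L) c≢b
    }
    where
    open Subdivision sub

    ≢w : ∀ {x} → x ∈ pathVertices s (X ++ Y) t → x ≢ w
    ≢w x∈ = ∈-∉⇒≢ x∈ w∉P

    a≢w : a ≢ w
    a≢w = ≢w (there (∈-++⁺ˡ a∈I))

    a∈H : a ∈ V G ++ (X ++ Y)
    a∈H = ∈-++⁺ʳ (V G) a∈I

    merge-into-H : ∀ {x} → x ∈ w ∷ V G ++ (X ++ Y) → merge w a x ∈ V G ++ (X ++ Y)
    merge-into-H = merge-∈ a∈H w∉H

    f-edge : ∀ {e₁ e₂} → (e₁ , e₂) ∈ E (G ⋎ (s , X ++ w ∷ Y , t)) →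
      (merge w a e₁ , merge w a e₂) ∈ E (G ⋎ (s , X ++ Y , t)) ⊎ SameEdge (e₁ , e₂) (a , w)
    f-edge m with ∈-++⁻ (E G) m
    ... | inj₁ mG = inj₁ (∈-++⁺ˡ (merge-∈-edges (∈-∉⇒≢ (proj₁ (G-endpoints mG)) w∉G)
                                                 (∈-∉⇒≢ (proj₂ (G-endpoints mG)) w∉G) mG))
    ... | inj₂ mP = Sum.map₁ (∈-++⁺ʳ (E G)) (merge-edges mP)

  embedding : ∀ {k} → 1 ≤ length (X ++ Y) → BookEmbedding k (G ⋎ (s , X ++ Y , t)) →
    BookEmbedding k (G ⋎ (s , X ++ w ∷ Y , t))
  embedding {k} len B with window s X Y t len
  ... | a , a∈I , W = expandEmbedding B page (contraction a∈I (subdivision subdivided-unique w∉P W))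
    where
    page : Fin k
    page = BookEmbedding.σ B (index (∈-++⁺ʳ (E G) (proj₂ (pathEdges-nonempty s (X ++ Y) t))))

mainTheorem15 : (k : ℕ) (G : Graph) (s t : ℕ) (I : List ℕ)
    → IsGraph G
    → IsPath s I t
    → 1 ≤ length I
    → NearDisjoint G s I t
    → BookEmbedding k (G ⋎ (s , I , t))
    → (i w : ℕ) → i ≤ length I
    → w ∉ V G → w ∉ pathVertices s I t
    → BookEmbedding k (G ⋎ (s , subdivideInterior i w I , t))
mainTheorem15 k G s t I isGraph path len nd B i w _ w∉G w∉P =
  subdivide (sym (take++drop≡id i I)) path len nd B w∉P
  where
  subdivide : ∀ {J} → J ≡ take i I ++ drop i I →
    IsPath s J t → 1 ≤ length J → NearDisjoint G s J t →
    BookEmbedding k (G ⋎ (s , J , t)) → w ∉ pathVertices s J t →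
    BookEmbedding k (G ⋎ (s , subdivideInterior i w I , t))
  subdivide refl path len nd B w∉P =
    SubdividedPath.embedding (take i I) (drop i I) isGraph path nd w∉G w∉P len B
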